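{- Let $\mathcal{V}=(Q,D,\Delta,w)$ be a 1-VASS with disequality tests and $s\in Q$. The configuration $(s,0)$ is unbounded if and only if $(s,0)$ can reach (via a valid run) an unbounded configuration in $\mathit{Conf}_+$.
   Context: A 1-VASS with disequality tests is $\mathcal{V}=(Q,D,\Delta,w)$: $Q$ a finite set of states, $D_q\subseteq\mathbb{N}$ cofinite for each $q$, $\Delta\subseteq Q\times Q$ transitions, $w:\Delta\to\mathbb{Z}$ weights. Configurations are pairs $(q,z)\in Q\times\mathbb{N}$, valid if $z\in D_q$. A path is a sequence of states $q_1,\dots,q_n$ with consecutive pairs in $\Delta$; its weight is the sum of the weights of its transitions; a cycle on $q$ is a path starting and ending at $q$. For a path $\pi$, $\mathrm{pmin}(\pi)$ is the minimum weight among all (possibly empty, weight $0$) prefixes of $\pi$. A run is a sequence of configurations with nonnegative counter values following a path, where each step adds the transition weight; it is valid if all its configurations are valid. $(q',z')$ is reachable from $(q,z)$ if there is a valid run from $(q,z)$ to $(q',z')$. A configuration is unbounded if the set of configurations reachable from it is infinite. Let $Q_+$ be the set of states $q$ lying on a positive-weight simple cycle; for each $q\in Q_+$ fix a positive-weight simple cycle $\gamma_q$ on $q$ with $\mathrm{pmin}(\gamma_q)\ge\mathrm{pmin}(\gamma)$ for every positive-weight simple cycle $\gamma$ on $q$. Define $\mathit{Conf}_+=\{(q,z)\in Q\times\mathbb{N}: q\in Q_+,\ z+\mathrm{pmin}(\gamma_q)\ge 0\}$. -}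

module Defs where

open import Data.Nat using (ℕ)
open import Data.Integer as ℤ using (ℤ; +_; _+_; _⊓_; _≤_; 0ℤ)
open import Data.Fin using (Fin)
open import Data.Bool using (Bool; true)
open import Data.List using (List; []; _∷_; _++_; [_])
open import Data.List.Membership.Propositional using (_∈_; _∉_)
open import Data.List.Relation.Unary.Unique.Propositional using (Unique)
open import Data.Product using (Σ; _×_; _,_; ∃; ∃-syntax)
open import Data.Unit using (⊤)
open import Relation.Binary.PropositionalEquality using (_≡_)

-- D_q is cofinite; it is represented by its (finite) complement:
--   D_q = { z ∈ ℕ | z ∉ forbidden q }.
-- Δ ⊆ Q × Q is given by its characteristic function; w gives the weight
-- of each transition (its value on non-transitions is irrelevant).
record VASS : Set where
  field
    n         : ℕ
    forbidden : Fin n → List ℕ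
    Δ         : Fin n → Fin n → Bool
    w         : Fin n → Fin n → ℤ

module _ (V : VASS) where
  open VASS V

  State : Set
  State = Fin n

  Conf : Set
  Conf = State × ℕ

  InD : State → ℕ → Set
  InD q z = z ∉ forbidden q

  Valid : Conf → Set
  Valid (q , z) = InD q z

  -- A path q₀ q₁ … qₖ is represented as its first state q₀ together
  -- with the list [q₁, …, qₖ].
  IsPath : State → List State → Set
  IsPath q []        = ⊤
  IsPath q (q' ∷ qs) = (Δ q q' ≡ true) × IsPath q' qs

  weight : State → List State → ℤ
  weight q []        = 0ℤ
  weight q (q' ∷ qs) = w q q' + weight q' qs

  -- minimum weight of all prefixes (the empty prefix has weight 0)
  pmin : State → List State → ℤ
  pmin q []        = 0ℤ
  pmin q (q' ∷ qs) = 0ℤ ⊓ (w q q' + pmin q' qs)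

  -- simple cycle on q: q q₁ … q_{k-1} q with q, q₁, …, q_{k-1} pairwise
  -- distinct (k ≥ 1)
  SimpleCycle : State → List State → Set
  SimpleCycle q qs =
    IsPath q qs × (∃[ rs ] (qs ≡ rs ++ [ q ] × Unique (q ∷ rs)))

  PosSimpleCycle : State → List State → Set
  PosSimpleCycle q qs = SimpleCycle q qs × (+ 1 ≤ weight q qs)

  InQ₊ : State → Set
  InQ₊ q = ∃[ qs ] PosSimpleCycle q qs

  Step : Conf → Conf → Set
  Step (q , z) (q' , z') = (Δ q q' ≡ true) × (+ z' ≡ + z + w q q')

  data Reach : Conf → Conf → Set where
    here  : ∀ {c} → Valid c → Reach c c
    there : ∀ {c c' c''} → Valid c → Step c c' → Reach c' c'' → Reach c c''

  -- a set of configurations is infinite: no finite list exhausts it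
  -- (constructive reading of "infinite").
  Infinite : (Conf → Set) → Set
  Infinite S = (xs : List Conf) → ∃[ c ] (S c × c ∉ xs)

  Unbounded : Conf → Set
  Unbounded c = Infinite (Reach c)

  record CycleChoice : Set where
    field
      γ     : (q : State) → InQ₊ q → List State
      γ-pos : (q : State) (h : InQ₊ q) → PosSimpleCycle q (γ q h)
      γ-max : (q : State) (h : InQ₊ q) (qs : List State) →
              PosSimpleCycle q qs → pmin q qs ≤ pmin q (γ q h)

  Conf₊ : CycleChoice → Conf → Set
  Conf₊ C (q , z) = Σ (InQ₊ q) λ h → 0ℤ ≤ + z + pmin q (CycleChoice.γ C q h)

module Submission where

-- "⇐" is transitivity of reachability.  For "⇒" fix W ≥ |w(t)| for every
-- transition t and F above every forbidden value, so that every
-- configuration with counter ≥ F is valid, and put M = F + nW + 1.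
--  * An unbounded (s,0) reaches configurations with arbitrarily large
--    counter, say (q,Z) with Z > M + W + nW.
--  * On that run, look at the suffix after the last configuration with
--    counter < M: it starts with counter ≤ M + W, so it follows a path of
--    weight > nW all of whose states are visited with counter ≥ M.
--  * A path of weight > nW visits a state of Q₊: cutting out innermost
--    (hence simple) cycles either exhibits a positive simple cycle or
--    does not decrease the weight, and a repetition-free path has at most
--    n states, hence weight ≤ nW.
--  * The Q₊-state r is visited with counter z ≥ M, and γ_r has at most n
--    transitions, so z + pmin(γ_r) ≥ F: iterating γ_r from (r,z) never
--    leaves the valid region and pumps the counter, so (r,z) is unbounded
--    (and lies in Conf₊).

open import Defs
open import Data.Nat as ℕ using (ℕ; zero; suc; z≤n; s≤s; s≤s⁻¹; _⊔_)
import Data.Nat.Properties as ℕP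
open import Data.Nat.Solver using (module +-*-Solver)
open import Data.Integer as ℤ using (ℤ; +_; -[1+_]; 0ℤ; +≤+; -≤+; -≤-)
import Data.Integer.Properties as ℤP
open import Data.Integer.Solver renaming (module +-*-Solver to ℤ-Solver)
open import Algebra.Properties.CommutativeSemigroup ℤP.+-commutativeSemigroup using (x∙yz≈y∙xz)
open import Data.Fin as Fin using (Fin)
open import Data.Fin.Properties using (injective⇒≤)
open import Data.List using (List; []; _∷_; _++_; [_]; length; map; lookup; allFin; upTo; cartesianProduct)
open import Data.List.Properties using (length-++)
open import Data.List.Membership.Propositional using (_∈_)
open import Data.List.Membership.Propositional.Properties
  using (∈-∃++; ∈-lookup; ∈-map⁺; ∈-allFin; ∈-upTo⁺; ∈-cartesianProduct⁺)
import Data.List.Membership.DecPropositional as DecMembership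
open import Data.List.Relation.Unary.Any using (here; there)
open import Data.List.Relation.Unary.All as All using (All; []; _∷_)
open import Data.List.Relation.Unary.All.Properties using (¬Any⇒All¬; ++⁺; ++⁻; ++⁻ˡ; ++⁻ʳ)
open import Data.List.Relation.Unary.AllPairs using ([]; _∷_)
open import Data.List.Relation.Unary.Unique.Propositional using (Unique)
open import Data.Product using (_×_; _,_; ∃-syntax; proj₁; proj₂)
open import Data.Sum using (_⊎_; inj₁; inj₂)
open import Data.Unit using (⊤; tt)
open import Data.Empty using (⊥-elim)
open import Relation.Nullary using (¬_; yes; no; contradiction)
open import Relation.Binary.Definitions using (DecidableEquality)
open import Relation.Binary.PropositionalEquality
  using (_≡_; refl; sym; trans; cong; subst; ≢-sym; module ≡-Reasoning)
open import Function.Bundles using (_⇔_; mk⇔)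

finBound : ∀ n (f : Fin n → ℕ) → ∃[ B ] (∀ i → f i ℕ.≤ B)
finBound zero    f = 0 , λ ()
finBound (suc n) f =
  let (B , f≤B) = finBound n (λ i → f (Fin.suc i)) in
  f Fin.zero ⊔ B , λ { Fin.zero    → ℕP.m≤m⊔n (f Fin.zero) B
                     ; (Fin.suc i) → ℕP.≤-trans (f≤B i) (ℕP.m≤n⊔m (f Fin.zero) B) }

listBound : (xs : List ℕ) → ∃[ B ] (∀ {x} → x ∈ xs → x ℕ.< B)
listBound []       = 0 , λ ()
listBound (x ∷ xs) =
  let (B , xs<B) = listBound xs in
  suc x ⊔ B , λ { (here refl) → ℕP.m≤m⊔n (suc x) B
                ; (there x∈)  → ℕP.<-≤-trans (xs<B x∈) (ℕP.m≤n⊔m (suc x) B) }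

module _ {A : Set} where

  prefixUnique : ∀ B {y : A} {C} → Unique (B ++ y ∷ C) → Unique (y ∷ B)
  prefixUnique []      _           = [] ∷ []
  prefixUnique (b ∷ B) (b∉ ∷ uniq) with prefixUnique B uniq
  ... | y∉B ∷ uniqB =
    (≢-sym (All.head (++⁻ʳ B b∉)) ∷ y∉B) ∷ (++⁻ˡ B b∉ ∷ uniqB)

  record InnerRepeat (ps : List A) : Set where
    constructor repeat
    field
      before inner after : List A
      x      : A
      split  : ps ≡ before ++ x ∷ inner ++ x ∷ after
      simple : Unique (x ∷ inner)

  uniqueOrRepeat : DecidableEquality A → (ps : List A) → Unique ps ⊎ InnerRepeat ps
  uniqueOrRepeat _≟_ []       = inj₁ []
  uniqueOrRepeat _≟_ (y ∷ ys) with uniqueOrRepeat _≟_ ys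
  ... | inj₂ (repeat P B C x refl simple) = inj₂ (repeat (y ∷ P) B C x refl simple)
  ... | inj₁ uniq with DecMembership._∈?_ _≟_ y ys
  ...   | no y∉ys  = inj₁ (¬Any⇒All¬ ys y∉ys ∷ uniq)
  ...   | yes y∈ys with ∈-∃++ y∈ys
  ...     | B , C , refl = inj₂ (repeat [] B C y refl (prefixUnique B uniq))

  cut-shorter : ∀ P (x : A) B C → length (P ++ x ∷ C) ℕ.< length (P ++ x ∷ B ++ x ∷ C)
  cut-shorter []      x B C = s≤s (suffix-shorter B)
    where
      suffix-shorter : ∀ B → length C ℕ.< length (B ++ x ∷ C)
      suffix-shorter []      = ℕP.n<1+n (length C)
      suffix-shorter (_ ∷ B) = ℕP.m<n⇒m<1+n (suffix-shorter B)
  cut-shorter (_ ∷ P) x B C = s≤s (cut-shorter P x B C)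

  cut-All : ∀ {Q : A → Set} P x B C → All Q (P ++ x ∷ B ++ x ∷ C) → Q x × All Q (P ++ x ∷ C)
  cut-All P x B C all with ++⁻ P all
  ... | allP , qx ∷ allBxC = qx , ++⁺ allP (++⁻ʳ B allBxC)

  lookup-injective : ∀ {xs : List A} (uniq : Unique xs) {i j} → lookup xs i ≡ lookup xs j → i ≡ j
  lookup-injective (_  ∷ _)    {Fin.zero}  {Fin.zero}  _  = refl
  lookup-injective (x∉ ∷ _)    {Fin.zero}  {Fin.suc j} eq = contradiction eq (All.lookup x∉ (∈-lookup j))
  lookup-injective (x∉ ∷ _)    {Fin.suc i} {Fin.zero}  eq = contradiction (sym eq) (All.lookup x∉ (∈-lookup i))
  lookup-injective (_  ∷ uniq) {Fin.suc i} {Fin.suc j} eq = cong Fin.suc (lookup-injective uniq eq)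

unique-length : ∀ {n} {xs : List (Fin n)} → Unique xs → length xs ℕ.≤ n
unique-length uniq = injective⇒≤ (lookup-injective uniq)

abs-bounds : ∀ i {b} → ℤ.∣ i ∣ ℕ.≤ b → ℤ.- (+ b) ℤ.≤ i × i ℤ.≤ + b
abs-bounds (+ m)    m≤b = ℤP.neg-≤-pos , +≤+ m≤b
abs-bounds -[1+ m ] {suc b} m<b = -≤- (s≤s⁻¹ m<b) , -≤+

non-positive : ∀ {i} → ¬ (+ 1 ℤ.≤ i) → i ℤ.≤ 0ℤ
non-positive {+ zero}    _    = ℤP.≤-refl
non-positive {+ suc _}   ¬pos = ⊥-elim (¬pos (+≤+ (s≤s z≤n)))
non-positive { -[1+ _ ]} _    = -≤+

shift-bound : ∀ a b c {d} → a ℕ.+ b ℕ.≤ c → ℤ.- (+ b) ℤ.≤ d → + a ℤ.≤ + c ℤ.+ d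
shift-bound a b c {d} a+b≤c -b≤d = subst (ℤ._≤ + c ℤ.+ d) a+b-b≡a (ℤP.+-mono-≤ (+≤+ a+b≤c) -b≤d)
  where
    open ℤ-Solver
    a+b-b≡a : + (a ℕ.+ b) ℤ.+ ℤ.- (+ b) ≡ + a
    a+b-b≡a = trans (cong (ℤ._+ ℤ.- (+ b)) (ℤP.pos-+ a b))
                    (solve 2 (λ x y → (x :+ y) :+ :- y := x) refl (+ a) (+ b))

gain-bound : ∀ {Z z i b} → + Z ≡ + z ℤ.+ i → i ℤ.≤ + b → Z ℕ.≤ z ℕ.+ b
gain-bound {Z} {z} {i} {b} gain i≤b = ℤP.drop‿+≤+ (begin
  + Z          ≡⟨ gain ⟩
  + z ℤ.+ i    ≤⟨ ℤP.+-monoʳ-≤ (+ z) i≤b ⟩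
  + z ℤ.+ + b  ≡⟨ ℤP.pos-+ z b ⟨
  + (z ℕ.+ b)  ∎)
  where open ℤP.≤-Reasoning

-- Walks: a path q qs is viewed as the full list q ∷ qs of its states, so
-- that cutting and joining paths at an intermediate state is uniform.

module Walks (V : VASS) where
  open VASS V

  IsWalk : List (State V) → Set
  IsWalk []       = ⊤
  IsWalk (q ∷ qs) = IsPath V q qs

  walkWeight : List (State V) → ℤ
  walkWeight []       = 0ℤ
  walkWeight (q ∷ qs) = weight V q qs

  walk-split : ∀ P x D → IsWalk (P ++ x ∷ D) → IsWalk (P ++ [ x ]) × IsWalk (x ∷ D)
  walk-split []          x D walk           = tt , walk
  walk-split (a ∷ [])    x D (a→x , walk)   = (a→x , tt) , walk
  walk-split (a ∷ b ∷ P) x D (a→b , walk) =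
    let (walkP , walkD) = walk-split (b ∷ P) x D walk in (a→b , walkP) , walkD

  walk-join : ∀ P x D → IsWalk (P ++ [ x ]) → IsWalk (x ∷ D) → IsWalk (P ++ x ∷ D)
  walk-join []          x D _              walkD = walkD
  walk-join (a ∷ [])    x D (a→x , _)      walkD = a→x , walkD
  walk-join (a ∷ b ∷ P) x D (a→b , walkP) walkD = a→b , walk-join (b ∷ P) x D walkP walkD

  walkWeight-split : ∀ P x D →
    walkWeight (P ++ x ∷ D) ≡ walkWeight (P ++ [ x ]) ℤ.+ walkWeight (x ∷ D)
  walkWeight-split []          x D = sym (ℤP.+-identityˡ _)
  walkWeight-split (a ∷ [])    x D = cong (ℤ._+ weight V x D) (sym (ℤP.+-identityʳ (w a x)))
  walkWeight-split (a ∷ b ∷ P) x D =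
    trans (cong (λ t → w a b ℤ.+ t) (walkWeight-split (b ∷ P) x D)) (sym (ℤP.+-assoc (w a b) _ _))

  cut-walk : ∀ P x B C → IsWalk (P ++ x ∷ B ++ x ∷ C) →
    IsPath V x (B ++ [ x ]) × IsWalk (P ++ x ∷ C)
  cut-walk P x B C walk =
    let (walkP , walkxBxC) = walk-split P x (B ++ x ∷ C) walk
        (cycle , walkxC)   = walk-split (x ∷ B) x C walkxBxC
    in cycle , walk-join P x C walkP walkxC

  cut-weight : ∀ P x B C →
    walkWeight (P ++ x ∷ B ++ x ∷ C) ≡ weight V x (B ++ [ x ]) ℤ.+ walkWeight (P ++ x ∷ C)
  cut-weight P x B C = begin
    walkWeight (P ++ x ∷ B ++ x ∷ C)  ≡⟨ walkWeight-split P x (B ++ x ∷ C) ⟩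
    head ℤ.+ walkWeight (x ∷ B ++ x ∷ C)  ≡⟨ cong (λ t → head ℤ.+ t) (walkWeight-split (x ∷ B) x C) ⟩
    head ℤ.+ (cycle ℤ.+ tail)  ≡⟨ x∙yz≈y∙xz head cycle tail ⟩
    cycle ℤ.+ (head ℤ.+ tail)  ≡⟨ cong (λ t → cycle ℤ.+ t) (walkWeight-split P x C) ⟨
    cycle ℤ.+ walkWeight (P ++ x ∷ C)  ∎
    where
      open ≡-Reasoning
      head  = walkWeight (P ++ [ x ])
      cycle = weight V x (B ++ [ x ])
      tail  = walkWeight (x ∷ C)

  endpoint : State V → List (State V) → State V
  endpoint q []       = q
  endpoint q (x ∷ xs) = endpoint x xs

  endpoint-snoc : ∀ q xs y → endpoint q (xs ++ [ y ]) ≡ y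
  endpoint-snoc q []       y = refl
  endpoint-snoc q (x ∷ xs) y = endpoint-snoc x xs y

  cycle-endpoint : ∀ {q qs} → SimpleCycle V q qs → endpoint q qs ≡ q
  cycle-endpoint {q} (_ , rs , refl , _) = endpoint-snoc q rs q

  cycle-length : ∀ {q qs} → SimpleCycle V q qs → length qs ℕ.≤ n
  cycle-length {q} (_ , rs , refl , uniq) =
    subst (ℕ._≤ n) (trans (ℕP.+-comm 1 (length rs)) (sym (length-++ rs))) (unique-length uniq)

  pmin≤0 : ∀ q qs → pmin V q qs ℤ.≤ 0ℤ
  pmin≤0 q []       = ℤP.≤-refl
  pmin≤0 q (_ ∷ qs) = ℤP.i⊓j≤i 0ℤ _

  ≤-pmin⇒≤ : ∀ {i} j q qs → i ℤ.≤ j ℤ.+ pmin V q qs → i ℤ.≤ j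
  ≤-pmin⇒≤ j q qs i≤ = subst (_ ℤ.≤_) (ℤP.+-identityʳ j) (ℤP.≤-trans i≤ (ℤP.+-monoʳ-≤ j (pmin≤0 q qs)))

module BoundedWeights (V : VASS) (W : ℕ) (w-bound : ∀ q q' → ℤ.∣ VASS.w V q q' ∣ ℕ.≤ W) where
  open VASS V
  open Walks V

  walkWeight-≤ : ∀ ps → walkWeight ps ℤ.≤ + (length ps ℕ.* W)
  walkWeight-≤ []            = +≤+ z≤n
  walkWeight-≤ (q ∷ [])      = +≤+ z≤n
  walkWeight-≤ (q ∷ q' ∷ qs) =
    subst (w q q' ℤ.+ weight V q' qs ℤ.≤_) (sym (ℤP.pos-+ W _))
      (ℤP.+-mono-≤ (proj₂ (abs-bounds (w q q') (w-bound q q'))) (walkWeight-≤ (q' ∷ qs)))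

  pmin-≥ : ∀ q qs → ℤ.- (+ (length qs ℕ.* W)) ℤ.≤ pmin V q qs
  pmin-≥ q []        = ℤP.≤-refl
  pmin-≥ q (q' ∷ qs) = ℤP.⊓-glb ℤP.neg-≤-pos
    (subst (ℤ._≤ w q q' ℤ.+ pmin V q' qs) (sym -[W+l]≡-W-l)
      (ℤP.+-mono-≤ (proj₁ (abs-bounds (w q q') (w-bound q q'))) (pmin-≥ q' qs)))
    where
      -[W+l]≡-W-l : ℤ.- (+ (W ℕ.+ length qs ℕ.* W)) ≡ ℤ.- (+ W) ℤ.+ ℤ.- (+ (length qs ℕ.* W))
      -[W+l]≡-W-l = trans (cong ℤ.-_ (ℤP.pos-+ W _)) (ℤP.neg-distrib-+ (+ W) _)

  simpleCycle-pmin : ∀ {q qs} → SimpleCycle V q qs → ℤ.- (+ (n ℕ.* W)) ℤ.≤ pmin V q qs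
  simpleCycle-pmin {q} {qs} cycle =
    ℤP.≤-trans (ℤP.neg-mono-≤ (+≤+ (ℕP.*-monoˡ-≤ W (cycle-length cycle)))) (pmin-≥ q qs)

  step-≤ : ∀ {q z q' z'} → Step V (q , z) (q' , z') → z' ℕ.≤ z ℕ.+ W
  step-≤ {q} {q' = q'} (_ , z'≡) = gain-bound z'≡ (proj₂ (abs-bounds (w q q') (w-bound q q')))

  -- Innermost cycles are cut out one by one; a non-positive one only
  -- lowers the weight, and a repetition-free walk has at most n states.
  positiveCycleOrBounded : (Q : State V → Set) → ∀ ps → IsWalk ps → All Q ps →
    (∃[ r ] (Q r × InQ₊ V r)) ⊎ walkWeight ps ℤ.≤ + (n ℕ.* W)
  positiveCycleOrBounded Q ps = cut (suc (length ps)) ps ℕP.≤-refl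
    where
      cut : ∀ fuel ps → length ps ℕ.< fuel → IsWalk ps → All Q ps →
        (∃[ r ] (Q r × InQ₊ V r)) ⊎ walkWeight ps ℤ.≤ + (n ℕ.* W)
      cut (suc fuel) ps ps<fuel walk allQ with uniqueOrRepeat Fin._≟_ ps
      ... | inj₁ uniq = inj₂ (ℤP.≤-trans (walkWeight-≤ ps) (+≤+ (ℕP.*-monoˡ-≤ W (unique-length uniq))))
      ... | inj₂ (repeat P B C x refl simple)
        with cut-walk P x B C walk | cut-All P x B C allQ
      ...   | cycle , rest | Qx , allQ-rest
        with + 1 ℤ.≤? weight V x (B ++ [ x ])
      ...     | yes positive = inj₁ (x , Qx , B ++ [ x ] , (cycle , B , refl , simple) , positive)
      ...     | no ¬positive
        with cut fuel (P ++ x ∷ C) (ℕP.<-≤-trans (cut-shorter P x B C) (s≤s⁻¹ ps<fuel)) rest allQ-rest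
      ...       | inj₁ found = inj₁ found
      ...       | inj₂ bounded = inj₂ (begin
        walkWeight (P ++ x ∷ B ++ x ∷ C)                    ≡⟨ cut-weight P x B C ⟩
        weight V x (B ++ [ x ]) ℤ.+ walkWeight (P ++ x ∷ C)  ≤⟨ ℤP.+-mono-≤ (non-positive ¬positive) bounded ⟩
        0ℤ ℤ.+ + (n ℕ.* W)                                  ≡⟨ ℤP.+-identityˡ _ ⟩
        + (n ℕ.* W)                                         ∎)
        where open ℤP.≤-Reasoning

module Runs (V : VASS) where
  open VASS V

  Reach-trans : ∀ {a b c} → Reach V a b → Reach V b c → Reach V a c
  Reach-trans (here _)          b→c = b→c
  Reach-trans (there va step r) b→c = there va step (Reach-trans r b→c)

  Reach-snoc : ∀ {a b c} → Reach V a b → Step V b c → Valid V c → Reach V a c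
  Reach-snoc (here vb)          step vc = there vb step (here vc)
  Reach-snoc (there va step' r) step vc = there va step' (Reach-snoc r step vc)

  Reach-valid : ∀ {a b} → Reach V a b → Valid V a
  Reach-valid (here va)      = va
  Reach-valid (there va _ _) = va

  reach-unbounded : ∀ {a b} → Reach V a b → Unbounded V b → Unbounded V a
  reach-unbounded a→b unbounded xs =
    let (c , b→c , c∉xs) = unbounded xs in c , Reach-trans a→b b→c , c∉xs

  -- Since there are finitely many states, a set of configurations is
  -- infinite exactly when it has configurations with arbitrarily large
  -- counter.
  Infinite⇒large : ∀ {S} → Infinite V S → ∀ k → ∃[ c ] (S c × k ℕ.≤ proj₂ c)
  Infinite⇒large infinite k with infinite (cartesianProduct (allFin n) (upTo k))
  ... | (q , z) , Sc , c∉ with k ℕ.≤? z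
  ...   | yes k≤z = (q , z) , Sc , k≤z
  ...   | no  k≰z = contradiction (∈-cartesianProduct⁺ (∈-allFin q) (∈-upTo⁺ (ℕP.≰⇒> k≰z))) c∉

  large⇒Infinite : ∀ {S} → (∀ k → ∃[ c ] (S c × k ℕ.≤ proj₂ c)) → Infinite V S
  large⇒Infinite large xs =
    let (B , xs<B)    = listBound (map proj₂ xs)
        (c , Sc , B≤) = large B
    in c , Sc , λ c∈xs → ℕP.<⇒≱ (xs<B (∈-map⁺ proj₂ c∈xs)) B≤

module Pumping (V : VASS) (F : ℕ) (valid-above : ∀ q z → F ℕ.≤ z → InD V q z) where
  open VASS V
  open Walks V
  open Runs V

  start-above : ∀ q qs {z} → + F ℤ.≤ + z ℤ.+ pmin V q qs → F ℕ.≤ z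
  start-above q qs {z} above = ℤP.drop‿+≤+ (≤-pmin⇒≤ (+ z) q qs above)

  runAbove : ∀ q qs z {z'} → IsPath V q qs → + F ℤ.≤ + z ℤ.+ pmin V q qs →
    + z' ≡ + z ℤ.+ weight V q qs → Reach V (q , z) (endpoint q qs , z')
  runAbove q [] z _ above gain with ℤP.+-injective (trans gain (ℤP.+-identityʳ (+ z)))
  ... | refl = here (valid-above q z (start-above q [] above))
  runAbove q (q₁ ∷ qs) z {z'} (q→q₁ , path) above gain =
    there (valid-above q z (start-above q (q₁ ∷ qs) above)) (q→q₁ , z₁≡)
          (runAbove q₁ qs z₁ path above₁ gain₁)
    where
      open ℤP.≤-Reasoning
      next-above : + F ℤ.≤ (+ z ℤ.+ w q q₁) ℤ.+ pmin V q₁ qs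
      next-above = begin
        + F                                     ≤⟨ above ⟩
        + z ℤ.+ pmin V q (q₁ ∷ qs)
          ≤⟨ ℤP.+-monoʳ-≤ (+ z) (ℤP.i⊓j≤j 0ℤ (w q q₁ ℤ.+ pmin V q₁ qs)) ⟩
        + z ℤ.+ (w q q₁ ℤ.+ pmin V q₁ qs)       ≡⟨ ℤP.+-assoc (+ z) (w q q₁) (pmin V q₁ qs) ⟨
        (+ z ℤ.+ w q q₁) ℤ.+ pmin V q₁ qs       ∎
      z₁ : ℕ
      z₁ = ℤ.∣ + z ℤ.+ w q q₁ ∣
      z₁≡ : + z₁ ≡ + z ℤ.+ w q q₁
      z₁≡ = ℤP.0≤i⇒+∣i∣≡i (ℤP.≤-trans (+≤+ z≤n) (≤-pmin⇒≤ _ q₁ qs next-above))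
      above₁ : + F ℤ.≤ + z₁ ℤ.+ pmin V q₁ qs
      above₁ = subst (λ i → + F ℤ.≤ i ℤ.+ pmin V q₁ qs) (sym z₁≡) next-above
      gain₁ : + z' ≡ + z₁ ℤ.+ weight V q₁ qs
      gain₁ = trans gain (trans (sym (ℤP.+-assoc (+ z) (w q q₁) (weight V q₁ qs)))
                                (cong (ℤ._+ weight V q₁ qs) (sym z₁≡)))

  pump : ∀ r cycle z → IsPath V r cycle → endpoint r cycle ≡ r → + 1 ℤ.≤ weight V r cycle →
    + F ℤ.≤ + z ℤ.+ pmin V r cycle → Unbounded V (r , z)
  pump r cycle z path closed positive above =
    large⇒Infinite (λ k → (r , k ℕ.* g ℕ.+ z) , iterate k z above , k≤kg+z k)
    where
      g : ℕ
      g = ℤ.∣ weight V r cycle ∣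
      g≡ : + g ≡ weight V r cycle
      g≡ = ℤP.0≤i⇒+∣i∣≡i (ℤP.≤-trans (+≤+ z≤n) positive)
      1≤g : 1 ℕ.≤ g
      1≤g = ℤP.drop‿+≤+ (subst (+ 1 ℤ.≤_) (sym g≡) positive)

      round : ∀ z → + F ℤ.≤ + z ℤ.+ pmin V r cycle → Reach V (r , z) (r , z ℕ.+ g)
      round z above = subst (λ q → Reach V (r , z) (q , z ℕ.+ g)) closed
        (runAbove r cycle z path above (trans (ℤP.pos-+ z g) (cong (λ i → + z ℤ.+ i) g≡)))

      iterate : ∀ k z → + F ℤ.≤ + z ℤ.+ pmin V r cycle → Reach V (r , z) (r , k ℕ.* g ℕ.+ z)
      iterate zero    z above = here (valid-above r z (start-above r cycle above))
      iterate (suc k) z above =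
        Reach-trans (round z above)
          (subst (λ t → Reach V (r , z ℕ.+ g) (r , t)) (regroup k z) (iterate k (z ℕ.+ g) raised))
        where
          raised : + F ℤ.≤ + (z ℕ.+ g) ℤ.+ pmin V r cycle
          raised = ℤP.≤-trans above (ℤP.+-monoˡ-≤ (pmin V r cycle) (+≤+ (ℕP.m≤m+n z g)))
          regroup : ∀ k z → k ℕ.* g ℕ.+ (z ℕ.+ g) ≡ suc k ℕ.* g ℕ.+ z
          regroup k z = solve 3 (λ k g z → k :* g :+ (z :+ g) := (g :+ k :* g) :+ z) refl k g z
            where open +-*-Solver

      k≤kg+z : ∀ k → k ℕ.≤ k ℕ.* g ℕ.+ z
      k≤kg+z k = ℕP.≤-trans (ℕP.m≤m*n k g {{ℕ.>-nonZero 1≤g}}) (ℕP.m≤m+n _ z)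

module HighSuffix (V : VASS) (W : ℕ) (w-bound : ∀ q q' → ℤ.∣ VASS.w V q q' ∣ ℕ.≤ W) (m : ℕ) where
  open VASS V
  open Runs V
  open BoundedWeights V W w-bound using (step-≤)

  HighVisit : Conf V → State V → Set
  HighVisit o r = ∃[ z ] (m ℕ.≤ z × Reach V o (r , z))

  record HighPath (o d e : Conf V) : Set where
    constructor highPath
    field
      states : List (State V)
      isPath : IsPath V (proj₁ d) states
      gain   : + proj₂ e ≡ + proj₂ d ℤ.+ weight V (proj₁ d) states
      high   : All (HighVisit o) (proj₁ d ∷ states)

  highSuffix : ∀ {o c e} → Reach V o c → Reach V c e → m ℕ.≤ proj₂ e →
    (m ℕ.≤ proj₂ c × HighPath o c e) ⊎ ∃[ d ] (proj₂ d ℕ.≤ m ℕ.+ W × HighPath o d e)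
  highSuffix o→c (here _) m≤e =
    inj₁ (m≤e , highPath [] tt (sym (ℤP.+-identityʳ _)) ((_ , m≤e , o→c) ∷ []))
  highSuffix {c = q , z} {e = _ , zₑ} o→c (there {c' = q₁ , _} _ step c'→e) m≤e
    with highSuffix (Reach-snoc o→c step (Reach-valid c'→e)) c'→e m≤e
  ... | inj₂ later = inj₂ later
  ... | inj₁ (_ , highPath qs path gain high) with m ℕ.≤? z
  ...   | yes m≤z = inj₁ (m≤z , highPath (_ ∷ qs) (proj₁ step , path) gain' ((z , m≤z , o→c) ∷ high))
    where
      gain' : + zₑ ≡ + z ℤ.+ weight V q (q₁ ∷ qs)
      gain' = trans gain (trans (cong (ℤ._+ weight V q₁ qs) (proj₂ step))
                                (ℤP.+-assoc (+ z) (w q q₁) (weight V q₁ qs)))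
  ...   | no  m≰z = inj₂ (_ , ℕP.≤-trans (step-≤ step) (ℕP.+-monoˡ-≤ W (ℕP.<⇒≤ (ℕP.≰⇒> m≰z))) ,
                          highPath qs path gain high)

module Proposition4 (V : VASS) (C : CycleChoice V) where
  open VASS V
  open CycleChoice C
  open Walks V
  open Runs V

  W : ℕ
  W = proj₁ (finBound n (λ q → proj₁ (finBound n (λ q' → ℤ.∣ w q q' ∣))))

  w-bound : ∀ q q' → ℤ.∣ w q q' ∣ ℕ.≤ W
  w-bound q q' = ℕP.≤-trans (proj₂ (finBound n (λ q' → ℤ.∣ w q q' ∣)) q')
                            (proj₂ (finBound n (λ q → proj₁ (finBound n (λ q' → ℤ.∣ w q q' ∣)))) q)

  F : ℕ
  F = proj₁ (finBound n (λ q → proj₁ (listBound (forbidden q))))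

  valid-above : ∀ q z → F ℕ.≤ z → InD V q z
  valid-above q z F≤z z-forbidden = ℕP.<⇒≱
    (ℕP.<-≤-trans (proj₂ (listBound (forbidden q)) z-forbidden)
                  (proj₂ (finBound n (λ q → proj₁ (listBound (forbidden q)))) q))
    F≤z

  -- Counters ≥ M leave room for a whole simple cycle above F.
  M : ℕ
  M = suc (F ℕ.+ n ℕ.* W)

  open BoundedWeights V W w-bound
  open Pumping V F valid-above
  open HighSuffix V W w-bound M

  high-Q₊-unbounded : ∀ {r z} → InQ₊ V r → M ℕ.≤ z → Conf₊ V C (r , z) × Unbounded V (r , z)
  high-Q₊-unbounded {r} {z} r∈Q₊ M≤z =
    (r∈Q₊ , ℤP.≤-trans (+≤+ z≤n) above) ,
    pump r (γ r r∈Q₊) z (proj₁ simple) (cycle-endpoint simple) positive above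
    where
      simple : SimpleCycle V r (γ r r∈Q₊)
      simple = proj₁ (γ-pos r r∈Q₊)
      positive : + 1 ℤ.≤ weight V r (γ r r∈Q₊)
      positive = proj₂ (γ-pos r r∈Q₊)
      above : + F ℤ.≤ + z ℤ.+ pmin V r (γ r r∈Q₊)
      above = shift-bound F (n ℕ.* W) z (ℕP.<⇒≤ M≤z) (simpleCycle-pmin simple)

  M≤-above : ∀ {Z} → M ℕ.+ W ℕ.+ n ℕ.* W ℕ.< Z → M ℕ.≤ Z
  M≤-above large =
    ℕP.<⇒≤ (ℕP.≤-<-trans (ℕP.≤-trans (ℕP.m≤m+n M W) (ℕP.m≤m+n (M ℕ.+ W) (n ℕ.* W))) large)

  -- The run to a configuration with counter above M + W + nW has a high
  -- suffix of weight > nW, which must visit a state of Q₊.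
  forward : ∀ s → Unbounded V (s , 0) → ∃[ c ] (Reach V (s , 0) c × Conf₊ V C c × Unbounded V c)
  forward s unbounded with Infinite⇒large unbounded (suc (M ℕ.+ W ℕ.+ n ℕ.* W))
  ... | (_ , Z) , s→e , Z-large
    with highSuffix (here (Reach-valid s→e)) s→e (M≤-above Z-large)
  ... | inj₁ (() , _)
  ... | inj₂ ((q₀ , z₀) , z₀≤ , highPath qs path gain high)
    with positiveCycleOrBounded (HighVisit (s , 0)) (q₀ ∷ qs) path high
  ... | inj₂ bounded = ⊥-elim (ℕP.<⇒≱ Z-large
          (ℕP.≤-trans (gain-bound gain bounded) (ℕP.+-monoˡ-≤ (n ℕ.* W) z₀≤)))
  ... | inj₁ (r , (z , M≤z , s→r) , r∈Q₊) = (r , z) , s→r , high-Q₊-unbounded r∈Q₊ M≤z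

proposition4 : (V : VASS) (C : CycleChoice V) (s : State V) →
    Unbounded V (s , 0) ⇔ (∃[ c ] (Reach V (s , 0) c × Conf₊ V C c × Unbounded V c))
proposition4 V C s =
  mk⇔ (Proposition4.forward V C s)
      (λ (c , s→c , _ , unbounded) → Runs.reach-unbounded V s→c unbounded)
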